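{- There exist a connected graph $G$ of order $n\geq 2$ and a graph $H$ with $k\geq 1$ connected components $H_1,\ldots,H_k$ such that $\chi_L(G\odot H)=\max\{\chi_L(H_t+K_1): 1\leq t\leq k\}$.
   Context: All graphs are finite and simple. For a connected graph $G$, a $k$-coloring is a map $c:V(G)\to\{1,\ldots,k\}$ with $c(u)\neq c(v)$ whenever $uv\in E(G)$; it induces the partition $\Pi=\{C_1,\ldots,C_k\}$ into color classes. The color code of $v$ is $c_\Pi(v)=(d(v,C_1),\ldots,d(v,C_k))$, where $d(v,C_i)=\min\{d(v,x): x\in C_i\}$. The coloring is locating if distinct vertices have distinct color codes; $\chi_L(G)$ is the least $k$ admitting a locating $k$-coloring. The corona product $G\odot H$ (for $V(G)=\{a_1,\ldots,a_n\}$) is obtained from one copy of $G$ and $n$ copies of $H$ by joining $a_i$ to every vertex of the $i$-th copy of $H$. $H_t+K_1$ denotes the join of $H_t$ with a single new vertex adjacent to all vertices of $H_t$. -}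

module Defs where

open import Data.Nat using (ℕ; zero; suc; _≤_)
open import Data.Fin using (Fin; _≟_)
open import Data.Bool using (Bool; true; false; _∧_)
open import Data.Maybe using (Maybe; just; nothing)
open import Data.Sum using (_⊎_; inj₁; inj₂)
open import Data.Product using (Σ; ∃; ∃-syntax; _×_; _,_; proj₁)
open import Relation.Nullary using (¬_)
open import Relation.Nullary.Decidable using (⌊_⌋)
open import Relation.Binary.PropositionalEquality using (_≡_; _≢_)

Graph : Set → Set
Graph V = V → V → Bool

IsSimple : {V : Set} → Graph V → Set
IsSimple {V} G = (∀ (u v : V) → G u v ≡ G v u) × (∀ (u : V) → G u u ≡ false)

data Walk {V : Set} (G : Graph V) : V → V → ℕ → Set where
  here : ∀ {u} → Walk G u u zero
  step : ∀ {u w v l} → G u w ≡ true → Walk G w v l → Walk G u v (suc l)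

Connected : {V : Set} → Graph V → Set
Connected {V} G = ∀ (u v : V) → ∃[ l ] Walk G u v l

Dist : {V : Set} → Graph V → V → V → ℕ → Set
Dist G u v d = Walk G u v d × (∀ l → Walk G u v l → d ≤ l)

DistToClass : {V : Set} {k : ℕ} → Graph V → (V → Fin k) → V → Fin k → ℕ → Set
DistToClass G c v i d =
  (∃[ x ] (c x ≡ i × Dist G v x d)) ×
  (∀ x e → c x ≡ i → Dist G v x e → d ≤ e)

Proper : {V : Set} {k : ℕ} → Graph V → (V → Fin k) → Set
Proper G c = ∀ u v → G u v ≡ true → c u ≢ c v

AllClassesNonempty : {V : Set} {k : ℕ} → (V → Fin k) → Set
AllClassesNonempty c = ∀ i → ∃[ x ] c x ≡ i

Locating : {V : Set} {k : ℕ} → Graph V → (V → Fin k) → Set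
Locating G c = ∀ u v → u ≢ v →
  ∃[ i ] ∃[ a ] ∃[ b ] (DistToClass G c u i a × DistToClass G c v i b × a ≢ b)

LocatingColoring : {V : Set} → Graph V → (k : ℕ) → (V → Fin k) → Set
LocatingColoring G k c = Proper G c × AllClassesNonempty c × Locating G c

ChiL : {V : Set} → Graph V → ℕ → Set
ChiL {V} G k =
  (∃[ c ] LocatingColoring G k c) ×
  (∀ j (c : V → Fin j) → LocatingColoring G j c → k ≤ j)

-- Corona product G ⊙ H: vertices a_i (inj₁ i) and the copies (inj₂ (i , x)),
-- where (i , x) is vertex x of the i-th copy of H.
corona : {n m : ℕ} → Graph (Fin n) → Graph (Fin m) → Graph (Fin n ⊎ (Fin n × Fin m))
corona G H (inj₁ a) (inj₁ b) = G a b
corona G H (inj₁ a) (inj₂ (i , x)) = ⌊ a ≟ i ⌋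
corona G H (inj₂ (i , x)) (inj₁ a) = ⌊ i ≟ a ⌋
corona G H (inj₂ (i , x)) (inj₂ (j , y)) = ⌊ i ≟ j ⌋ ∧ H x y

-- H + K_1 : the new vertex is nothing.
joinK1 : {V : Set} → Graph V → Graph (Maybe V)
joinK1 H nothing nothing = false
joinK1 H nothing (just x) = true
joinK1 H (just x) nothing = true
joinK1 H (just x) (just y) = H x y

induced : {V : Set} → Graph V → (P : V → Set) → Graph (Σ V P)
induced H P u v = H (proj₁ u) (proj₁ v)

Class : {V : Set} {k : ℕ} → (V → Fin k) → Fin k → V → Set
Class comp t x = comp x ≡ t

-- comp labels the connected components of H as H_1,...,H_k:
-- each label class is nonempty and induces a connected subgraph,
-- and there are no edges between different classes.
IsComponents : {V : Set} {k : ℕ} → Graph V → (V → Fin k) → Set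
IsComponents H comp =
  (∀ t → ∃[ x ] comp x ≡ t) ×
  (∀ x y → H x y ≡ true → comp x ≡ comp y) ×
  (∀ t → Connected (induced H (Class comp t)))

component : {V : Set} {k : ℕ} → Graph V → (comp : V → Fin k) → (t : Fin k) → Graph (Σ V (Class comp t))
component H comp t = induced H (Class comp t)

-- A locating colouring must give different colours to adjacent vertices and to
-- twins (non-adjacent vertices with the same neighbourhood): twins of one colour
-- are at the same distance from every colour class, so they get the same code.
-- In K₂ ⊙ P₃ and in the fan P₃ + K₁ a dominating vertex, the centre of the path
-- and its two end vertices form a triangle together with a twin of one of its
-- vertices, so both graphs need 4 colours; 4 colours suffice, as an exhaustive
-- check of the colour codes (all distances to classes are at most 2) confirms.
module Submission where

open import Defs
open import Axiom.UniquenessOfIdentityProofs using (module Decidable⇒UIP)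
open import Data.Bool using (true; false; T; not)
open import Data.Bool.Properties using () renaming (_≟_ to _≟ᵇ_)
open import Data.Fin using (Fin; suc; _≟_; _<_)
open import Data.Fin.Patterns using (0F; 1F; 2F; 3F)
import Data.Fin.Properties as Fin
open import Data.List using (List; []; _∷_; _++_; map; length; lookup; allFin; cartesianProduct)
open import Data.List.Membership.Propositional using (_∈_; lose)
open import Data.List.Membership.Propositional.Properties
  using (∈-lookup; ∈-allFin; ∈-map⁺; ∈-++⁺ˡ; ∈-++⁺ʳ; ∈-cartesianProduct⁺)
open import Data.List.Relation.Unary.All as All using (All; []; _∷_; all?)
open import Data.List.Relation.Unary.AllPairs using (AllPairs; []; _∷_)
open import Data.List.Relation.Unary.Any using (here; there; any?; satisfied)
open import Data.Maybe using (Maybe; just; nothing; is-just; to-witness-T)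
open import Data.Maybe.Properties using () renaming (≡-dec to Maybe-≡-dec)
open import Data.Nat as ℕ using (ℕ; suc; _+_; _≤_; z≤n; s≤s)
open import Data.Nat.Properties using (≤-refl; ≤-antisym; ≰⇒>; _≤?_)
open import Data.Product using (Σ; ∃; ∃-syntax; _×_; _,_; proj₁; proj₂)
open import Data.Product.Properties using () renaming (≡-dec to ×-≡-dec)
open import Data.Sum using (_⊎_; inj₁; inj₂)
open import Data.Sum.Properties using () renaming (≡-dec to ⊎-≡-dec)
open import Function using (_∘_)
open import Relation.Binary.PropositionalEquality using (_≡_; _≢_; refl; sym; trans)
open import Relation.Nullary using (¬_; Dec; yes; no; contradiction)
open import Relation.Nullary.Decidable
  using (⌊_⌋; from-yes; map′; _×-dec_; _⊎-dec_; _→-dec_; ¬?; T?)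
open import Relation.Unary using (Decidable)

module _ {V : Set} {G : Graph V} where

  _++ʷ_ : ∀ {u w v l l′} → Walk G u w l → Walk G w v l′ → Walk G u v (l + l′)
  here     ++ʷ q = q
  step e p ++ʷ q = step e (p ++ʷ q)

  dist-refl : ∀ {v} → Dist G v v 0
  dist-refl = here , λ _ _ → z≤n

  module _ {k : ℕ} {c : V → Fin k} where

    classDistance-intro : ∀ {v i x d} → c x ≡ i → Walk G v x d →
      (∀ {y l} → c y ≡ i → Walk G v y l → d ≤ l) → DistToClass G c v i d
    classDistance-intro cx≡i p below =
      (_ , cx≡i , p , λ _ → below cx≡i) , λ _ _ cy≡i → below cy≡i ∘ proj₁

    classDistance-zero : ∀ {v i} → c v ≡ i → DistToClass G c v i 0
    classDistance-zero cv≡i = classDistance-intro cv≡i here λ _ _ → z≤n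

    classDistance-one : ∀ {v i x} → c v ≢ i → G v x ≡ true → c x ≡ i →
                        DistToClass G c v i 1
    classDistance-one {v} {i} cv≢i e cx≡i = classDistance-intro cx≡i (step e here) below
      where
      below : ∀ {y l} → c y ≡ i → Walk G v y l → 1 ≤ l
      below cy≡i here       = contradiction cy≡i cv≢i
      below _    (step _ _) = s≤s z≤n

    classDistance-two : ∀ {v i w x} → c v ≢ i → (∀ y → G v y ≡ true → c y ≢ i) →
                        G v w ≡ true → G w x ≡ true → c x ≡ i → DistToClass G c v i 2
    classDistance-two {v} {i} cv≢i noNeighbour e e′ cx≡i =
      classDistance-intro cx≡i (step e (step e′ here)) below
      where
      below : ∀ {y l} → c y ≡ i → Walk G v y l → 2 ≤ l
      below cy≡i here                = contradiction cy≡i cv≢i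
      below cy≡i (step e here)       = contradiction cy≡i (noNeighbour _ e)
      below _    (step _ (step _ _)) = s≤s (s≤s z≤n)

Twins : {V : Set} → Graph V → V → V → Set
Twins G x w = ∀ u → G x u ≡ G w u

module _ {V : Set} {G : Graph V} where

  twins-sym : ∀ {x w} → Twins G x w → Twins G w x
  twins-sym tw u = sym (tw u)

  twins-walk : ∀ {x w} → Twins G x w → ∀ {y l} → Walk G x y (suc l) → Walk G w y (suc l)
  twins-walk tw (step e p) = step (trans (sym (tw _)) e) p

  -- A nearest vertex of the class is reached from the twin by a walk of the same
  -- length, and that walk is still shortest unless the twin itself lies in the
  -- class, which the common colour rules out.
  twins-classDistance-≤ : ∀ {x w} → Twins G x w → ∀ {k} {c : V → Fin k} → c x ≡ c w →
    ∀ {i a b} → DistToClass G c x i a → DistToClass G c w i b → b ≤ a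
  twins-classDistance-≤ {w = w} tw cx≡cw ((y , cy≡i , here , _) , _) (_ , nearest) =
    nearest w 0 (trans (sym cx≡cw) cy≡i) dist-refl
  twins-classDistance-≤ {x} {w} tw cx≡cw ((y , cy≡i , p@(step _ _) , shortest) , nearestₓ) (_ , nearest) =
    nearest y _ cy≡i (twins-walk tw p , shortest′)
    where
    shortest′ : ∀ l → Walk G w y l → _ ≤ l
    shortest′ _ here         = contradiction (nearestₓ x 0 (trans cx≡cw cy≡i) dist-refl) λ ()
    shortest′ _ q@(step _ _) = shortest _ (twins-walk (twins-sym tw) q)

  twins-sameColour-¬locating : ∀ {x w} → x ≢ w → Twins G x w → ∀ {k} {c : V → Fin k} →
                               c x ≡ c w → ¬ Locating G c
  twins-sameColour-¬locating {x} {w} x≢w tw cx≡cw locating with locating x w x≢w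
  ... | _ , _ , _ , dx , dw , a≢b =
    a≢b (≤-antisym (twins-classDistance-≤ (twins-sym tw) (sym cx≡cw) dw dx)
                   (twins-classDistance-≤ tw cx≡cw dx dw))

AdjacentOrTwins : {V : Set} → Graph V → V → V → Set
AdjacentOrTwins G u v = G u v ≡ true ⊎ (u ≢ v × Twins G u v)

allPairs-lookup : {V : Set} {R : V → V → Set} {xs : List V} → AllPairs R xs →
                  ∀ {i j : Fin (length xs)} → i < j → R (lookup xs i) (lookup xs j)
allPairs-lookup (Rx ∷ _)   {0F}    {suc j} _         = All.lookup Rx (∈-lookup j)
allPairs-lookup (_  ∷ Rxs) {suc i} {suc j} (s≤s i<j) = allPairs-lookup Rxs i<j

module _ {V : Set} {G : Graph V} {k : ℕ} {c : V → Fin k} (lc : LocatingColoring G k c) where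

  adjacentOrTwins-colour-≢ : ∀ {u v} → AdjacentOrTwins G u v → c u ≢ c v
  adjacentOrTwins-colour-≢ (inj₁ e)           = proj₁ lc _ _ e
  adjacentOrTwins-colour-≢ (inj₂ (u≢v , tw)) cu≡cv =
    twins-sameColour-¬locating u≢v tw cu≡cv (proj₂ (proj₂ lc))

  length-≤-colours : ∀ {vs} → AllPairs (AdjacentOrTwins G) vs → length vs ≤ k
  length-≤-colours {vs} ps with length vs ≤? k
  ... | yes ≤k = ≤k
  ... | no  ≰k with Fin.pigeonhole (≰⇒> ≰k) (c ∘ lookup vs)
  ...   | _ , _ , i<j , same =
          contradiction same (adjacentOrTwins-colour-≢ (allPairs-lookup ps i<j))

chiL-byAdjacentOrTwins : {V : Set} {G : Graph V} (vs : List V) → AllPairs (AdjacentOrTwins G) vs →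
  ∀ {c} → LocatingColoring G (length vs) c → ChiL G (length vs)
chiL-byAdjacentOrTwins _ ps lc = (_ , lc) , λ _ _ lc′ → length-≤-colours lc′ ps

module _ {V : Set} {G : Graph V} where

  universal-connected : IsSimple G → (h : V) → (∀ v → v ≡ h ⊎ G v h ≡ true) → Connected G
  universal-connected (symmetric , _) h near u v =
    _ , proj₂ (toHub u) ++ʷ proj₂ (fromHub v)
    where
    toHub : ∀ u → ∃ (Walk G u h)
    toHub u with near u
    ... | inj₁ refl = 0 , here
    ... | inj₂ e    = 1 , step e here
    fromHub : ∀ v → ∃ (Walk G h v)
    fromHub v with near v
    ... | inj₁ refl = 0 , here
    ... | inj₂ e    = 1 , step (trans (symmetric h v) e) here

induced-isSimple : {V : Set} {H : Graph V} {P : V → Set} → IsSimple H → IsSimple (induced H P)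
induced-isSimple (symmetric , loopless) =
  (λ u v → symmetric (proj₁ u) (proj₁ v)) , loopless ∘ proj₁

module Enumeration {V : Set} {vertices : List V} (∈-vertices : ∀ v → v ∈ vertices) where

  ∀? : {P : V → Set} → Decidable P → Dec (∀ v → P v)
  ∀? P? = map′ (λ ps v → All.lookup ps (∈-vertices v)) (λ ps → All.tabulate λ {v} _ → ps v)
               (all? P? vertices)

  ∃? : {P : V → Set} → Decidable P → Dec (∃ P)
  ∃? P? = map′ satisfied (λ (v , pv) → lose (∈-vertices v) pv) (any? P? vertices)

  isSimple? : (G : Graph V) → Dec (IsSimple G)
  isSimple? G = (∀? λ u → ∀? λ v → G u v ≟ᵇ G v u) ×-dec (∀? λ u → G u u ≟ᵇ false)

  twins? : (G : Graph V) → ∀ x w → Dec (Twins G x w)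
  twins? G x w = ∀? λ u → G x u ≟ᵇ G w u

  module _ (G : Graph V) {k : ℕ} (c : V → Fin k) where

    neighbourIn? : ∀ i v → Decidable (λ x → G v x ≡ true × c x ≡ i)
    neighbourIn? i v x = (G v x ≟ᵇ true) ×-dec (c x ≟ i)

    -- Only distances up to 2 are found; a larger one yields nothing, so the
    -- check below then fails instead of being unsound.
    classDistance? : ∀ v i → Maybe (∃ (DistToClass G c v i))
    classDistance? v i with c v ≟ i
    ... | yes cv≡i = just (0 , classDistance-zero cv≡i)
    ... | no  cv≢i with ∃? (neighbourIn? i v)
    ...   | yes (x , e , cx≡i) = just (1 , classDistance-one cv≢i e cx≡i)
    ...   | no  ¬neighbour with ∃? (λ w → (G v w ≟ᵇ true) ×-dec ∃? (neighbourIn? i w))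
    ...     | yes (w , e , x , e′ , cx≡i) = just (2 , classDistance-two cv≢i
                                              (λ y e cy≡i → ¬neighbour (y , e , cy≡i)) e e′ cx≡i)
    ...     | no _ = nothing

    Separates : V → V → Fin k → Set
    Separates u v i = ∃[ a ] ∃[ b ] (DistToClass G c u i a × DistToClass G c v i b × a ≢ b)

    separates? : ∀ u v i → Maybe (Separates u v i)
    separates? u v i with classDistance? u i | classDistance? v i
    ... | just (a , du) | just (b , dv) with a ℕ.≟ b
    ...   | no a≢b = just (a , b , du , dv , a≢b)
    ...   | yes _  = nothing
    separates? u v i | _ | _ = nothing

    Separated : V → V → Set
    Separated u v = u ≢ v → ∃ λ i → T (is-just (separates? u v i))

    separated⇒locating : (∀ u v → Separated u v) → Locating G c
    separated⇒locating sep u v u≢v with sep u v u≢v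
    ... | i , found = i , to-witness-T (separates? u v i) found

    locatingColoring? : (_≟ⱽ_ : (u v : V) → Dec (u ≡ v)) →
      Dec (Proper G c × AllClassesNonempty c × (∀ u v → Separated u v))
    locatingColoring? _≟ⱽ_ =
      (∀? λ u → ∀? λ v → (G u v ≟ᵇ true) →-dec ¬? (c u ≟ c v)) ×-dec
      (Fin.all? λ i → ∃? λ x → c x ≟ i) ×-dec
      (∀? λ u → ∀? λ v → ¬? (u ≟ⱽ v) →-dec Fin.any? λ i → T? _)

    locatingColoring : Proper G c × AllClassesNonempty c × (∀ u v → Separated u v) →
                       LocatingColoring G k c
    locatingColoring (proper , nonempty , sep) = proper , nonempty , separated⇒locating sep

coronaVertices : (n m : ℕ) → List (Fin n ⊎ (Fin n × Fin m))
coronaVertices n m = map inj₁ (allFin n) ++ map inj₂ (cartesianProduct (allFin n) (allFin m))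

∈-coronaVertices : ∀ {n m} v → v ∈ coronaVertices n m
∈-coronaVertices (inj₁ a)       = ∈-++⁺ˡ (∈-map⁺ inj₁ (∈-allFin a))
∈-coronaVertices (inj₂ (i , x)) =
  ∈-++⁺ʳ _ (∈-map⁺ inj₂ (∈-cartesianProduct⁺ (∈-allFin i) (∈-allFin x)))

withApex : {V : Set} → List V → List (Maybe V)
withApex vs = nothing ∷ map just vs

∈-withApex : {V : Set} {vs : List V} → (∀ v → v ∈ vs) → ∀ v → v ∈ withApex vs
∈-withApex ∈-vs nothing  = here refl
∈-withApex ∈-vs (just v) = there (∈-map⁺ just (∈-vs v))

oneComponent : {m : ℕ} → Fin m → Fin 1
oneComponent _ = 0F

Component₁ : ℕ → Set
Component₁ m = Σ (Fin m) (Class oneComponent 0F)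

component₁Vertices : ∀ m → List (Component₁ m)
component₁Vertices m = map (_, refl) (allFin m)

∈-component₁Vertices : ∀ {m} (v : Component₁ m) → v ∈ component₁Vertices m
∈-component₁Vertices (x , refl) = ∈-map⁺ (_, refl) (∈-allFin x)

component₁-≟ : ∀ {m} (u v : Component₁ m) → Dec (u ≡ v)
component₁-≟ = ×-≡-dec _≟_ λ p q → yes (Decidable⇒UIP.≡-irrelevant _≟_ p q)

module FinVertices {n : ℕ} = Enumeration (∈-allFin {n})
module Component₁Vertices {m : ℕ} = Enumeration (∈-component₁Vertices {m})
module FanVertices {m : ℕ} = Enumeration (∈-withApex (∈-component₁Vertices {m}))
module CoronaVertices {n m : ℕ} = Enumeration (∈-coronaVertices {n} {m})

K₂ : Graph (Fin 2)
K₂ x y = not ⌊ x ≟ y ⌋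

P₃ : Graph (Fin 3)
P₃ 0F 1F = true
P₃ 1F 0F = true
P₃ 1F 2F = true
P₃ 2F 1F = true
P₃ _  _  = false

K₂-isSimple : IsSimple K₂
K₂-isSimple = from-yes (FinVertices.isSimple? K₂)

P₃-isSimple : IsSimple P₃
P₃-isSimple = from-yes (FinVertices.isSimple? P₃)

K₂-connected : Connected K₂
K₂-connected = universal-connected K₂-isSimple 0F
  (from-yes (FinVertices.∀? λ v → (v ≟ 0F) ⊎-dec (K₂ v 0F ≟ᵇ true)))

P₃-oneComponent : IsComponents P₃ oneComponent
P₃-oneComponent = (λ { 0F → 0F , refl }) , (λ _ _ _ → refl) , λ { 0F → connected }
  where
  connected : Connected (component P₃ oneComponent 0F)
  connected = universal-connected (induced-isSimple P₃-isSimple) (1F , refl)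
    (from-yes (Component₁Vertices.∀? λ v →
      component₁-≟ v (1F , refl) ⊎-dec (component P₃ oneComponent 0F v (1F , refl) ≟ᵇ true)))

coronaColouring : Fin 2 ⊎ (Fin 2 × Fin 3) → Fin 4
coronaColouring (inj₁ 0F)        = 0F
coronaColouring (inj₁ 1F)        = 1F
coronaColouring (inj₂ (0F , 0F)) = 1F
coronaColouring (inj₂ (0F , 1F)) = 2F
coronaColouring (inj₂ (0F , 2F)) = 3F
coronaColouring (inj₂ (1F , 0F)) = 0F
coronaColouring (inj₂ (1F , 1F)) = 3F
coronaColouring (inj₂ (1F , 2F)) = 2F

corona-≟ : (u v : Fin 2 ⊎ (Fin 2 × Fin 3)) → Dec (u ≡ v)
corona-≟ = ⊎-≡-dec _≟_ (×-≡-dec _≟_ _≟_)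

chiL-corona : ChiL (corona K₂ P₃) 4
chiL-corona = chiL-byAdjacentOrTwins (inj₁ 0F ∷ inj₂ (0F , 1F) ∷ inj₂ (0F , 0F) ∷ inj₂ (0F , 2F) ∷ [])
  ((inj₁ refl ∷ inj₁ refl ∷ inj₁ refl ∷ []) ∷
   (inj₁ refl ∷ inj₁ refl ∷ []) ∷
   (inj₂ ((λ ()) , from-yes (CoronaVertices.twins? (corona K₂ P₃) (inj₂ (0F , 0F)) (inj₂ (0F , 2F)))) ∷ []) ∷
   [] ∷ [])
  (CoronaVertices.locatingColoring (corona K₂ P₃) coronaColouring
    (from-yes (CoronaVertices.locatingColoring? (corona K₂ P₃) coronaColouring corona-≟)))

fan : Graph (Maybe (Component₁ 3))
fan = joinK1 (component P₃ oneComponent 0F)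

fanColouring : Maybe (Component₁ 3) → Fin 4
fanColouring nothing         = 0F
fanColouring (just (0F , _)) = 2F
fanColouring (just (1F , _)) = 1F
fanColouring (just (2F , _)) = 3F

chiL-fan : ChiL fan 4
chiL-fan = chiL-byAdjacentOrTwins (nothing ∷ just (1F , refl) ∷ just (0F , refl) ∷ just (2F , refl) ∷ [])
  ((inj₁ refl ∷ inj₁ refl ∷ inj₁ refl ∷ []) ∷
   (inj₁ refl ∷ inj₁ refl ∷ []) ∷
   (inj₂ ((λ ()) , from-yes (FanVertices.twins? fan (just (0F , refl)) (just (2F , refl)))) ∷ []) ∷
   [] ∷ [])
  (FanVertices.locatingColoring fan fanColouring
    (from-yes (FanVertices.locatingColoring? fan fanColouring (Maybe-≡-dec component₁-≟))))

theorem2 : ∃[ n ] Σ (Graph (Fin n)) λ G → 2 ≤ n × IsSimple G × Connected G ×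
    ∃[ m ] Σ (Graph (Fin m)) λ H → IsSimple H ×
    ∃[ k ] 1 ≤ k × Σ (Fin m → Fin k) λ comp → IsComponents H comp ×
    ∃[ χ ] (ChiL (corona G H) χ ×
      (∃[ t ] ChiL (joinK1 (component H comp t)) χ) ×
      (∀ t → ∃[ c ] (ChiL (joinK1 (component H comp t)) c × c ≤ χ)))
theorem2 =
  2 , K₂ , s≤s (s≤s z≤n) , K₂-isSimple , K₂-connected ,
  3 , P₃ , P₃-isSimple ,
  1 , s≤s z≤n , oneComponent , P₃-oneComponent ,
  4 , chiL-corona , (0F , chiL-fan) , λ { 0F → 4 , chiL-fan , ≤-refl }
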